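{- Let $G=(V,E,w)$ be a connected undirected graph with $n=|V|$ vertices, maximum degree $D$, and real edge weights in $[1,W_{\max}]$. Run the procedure NT-RS$(V)$ described below and let $A$ and the sets $D_a$ ($a\in A$) be as computed in it. Then $G\subseteq\bigcup_{a\in A}G[D_a]$, where $G[D_a]$ is the subgraph of $G$ induced by $D_a$; that is, for every edge $uv\in E$ there is $a\in A$ with $u,v\in D_a$.
   Context: Queries (no threshold): $q_w(u,v)$ returns $w(u,v)$ if $uv\in E$ and $0$ otherwise; $q_d(u,v)$ returns the shortest weighted path distance $d(u,v)$ in $G$. Write $d(S,v)=\min_{s\in S}d(s,v)$. SAMPLE$(W,s)$ returns $W$ if $|W|\le s$, else each element independently with probability $s/|W|$. ESTIMATED-CENTERS$(V,s)$: $N=|V|$, $A=\emptyset$, $W=V$, $T=Ks\log N\log\log N$ ($K$ a fixed constant); while $W\ne\emptyset$: $A'=$SAMPLE$(W,s)$, query $q_d$ on $A'\times V$, $A\leftarrow A\cup A'$; for each $x\in W$ draw a random multiset $X$ of $T$ elements of $V$, query $q_d(y,x)$ for $y\in X$, let $\tilde C(x)=|\{y\in X:d(x,y)<d(A,y)\}|\cdot N/T$; set $W\leftarrow\{x\in W:\tilde C(x)\ge5N/s\}$; return $A$. NT-RS$(V)$: with $b=\frac{D^{2W_{\max}+1}-1}{D-1}$ and $s=\sqrt{bn}$, let $A=$ESTIMATED-CENTERS$(V,s)$; for each $a\in A$: let $N_2(a)=\bar B(a,2W_{\max})=\{v\in V: d(a,v)\le 2W_{\max}\}$, query $q_d$ on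 $N_2(a)\times V$, set $C(b')=\{v\in V:d(b',v)<d(A,v)\}$ for $b'\in N_2(a)$, $D_a=N_2(a)\cup\bigcup_{b'\in N_2(a)}C(b')$, and query $q_w$ on all pairs of $D_a$, collecting the edges found; return all collected edges.
   Formalization: The edge weights, the bound $W_{\max}$ and the distances $d(u,v)$ are rational rather than real. -}

module Defs where

open import Data.Nat as ℕ using (ℕ; zero; suc)
open import Data.Integer as ℤ using (ℤ)
open import Data.Rational as ℚ using (ℚ; _≤_; _<_; _+_; _*_; _/_; ↥_; ↧ₙ_; 0ℚ; 1ℚ)
open import Data.Rational.Properties using (_<?_)
open import Data.Fin using (Fin)
open import Data.Fin.Properties using (all?)
open import Data.Fin.Subset using (Subset; _∈_; _⊆_; ∣_∣; Empty; _∪_)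
open import Data.Fin.Subset.Properties using (_∈?_)
open import Data.Bool using (Bool; true)
open import Data.List using (List; length; filter)
open import Data.Vec using (tabulate)
open import Data.Product using (Σ; ∃; _×_)
open import Data.Sum using (_⊎_)
open import Relation.Nullary using (Dec; yes; no; ¬_)
open import Relation.Binary.PropositionalEquality using (_≡_)
open import Function.Bundles using (_⇔_)

record WGraph (n : ℕ) : Set where
  field
    adj : Fin n → Fin n → Bool
    w   : Fin n → Fin n → ℚ        -- edge weights (meaningful on edges)
open WGraph public

IsUndirected : ∀ {n} → WGraph n → Set
IsUndirected G = (∀ u v → adj G u v ≡ adj G v u)
               × (∀ u → ¬ (adj G u u ≡ true))
               × (∀ u v → w G u v ≡ w G v u)

WeightsIn : ∀ {n} → WGraph n → ℚ → Set
WeightsIn G Wmax = ∀ u v → adj G u v ≡ true → (1ℚ ≤ w G u v) × (w G u v ≤ Wmax)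

nbhd : ∀ {n} → WGraph n → Fin n → Subset n
nbhd G u = tabulate (adj G u)

deg : ∀ {n} → WGraph n → Fin n → ℕ
deg G u = ∣ nbhd G u ∣

IsMaxDegree : ∀ {n} → WGraph n → ℕ → Set
IsMaxDegree G D = (∀ u → deg G u ℕ.≤ D) × ∃ (λ u → deg G u ≡ D)

data Walk {n} (G : WGraph n) : Fin n → Fin n → Set where
  []  : ∀ {u} → Walk G u u
  _∷_ : ∀ {u v t} → adj G u v ≡ true → Walk G v t → Walk G u t

weight : ∀ {n} {G : WGraph n} {u v} → Walk G u v → ℚ
weight []                  = 0ℚ
weight {G = G} (_∷_ {u} {v} _ p) = w G u v + weight p

Connected : ∀ {n} → WGraph n → Set
Connected G = ∀ u v → Walk G u v

IsDistance : ∀ {n} → (G : WGraph n) → (Fin n → Fin n → ℚ) → Set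
IsDistance G d = ∀ u v → (Σ (Walk G u v) λ p → weight p ≡ d u v)
                       × (∀ (p : Walk G u v) → d u v ≤ weight p)

-- The real parameter b = (D^(2 Wmax + 1) - 1)/(D - 1) and s = sqrt(b n)
-- are only ever compared with nonnegative rationals; we encode
-- "x / c ≤ b" (x, c naturals, c > 0) exactly, in natural arithmetic.
-- Write Wmax = p / q in lowest terms (p = |numerator|, q = denominator).
-- For D ≥ 2:  x/c ≤ b  ⇔  1 + x(D-1)/c ≤ D^((2p+q)/q)
--                      ⇔  (c + x(D-1))^q ≤ c^q · D^(2p+q)
-- For D = 1 we use the limit value b = 2 Wmax + 1:  x q ≤ c (2p + q).
-- For D = 0, b = (0 - 1)/(0 - 1) = 1:  x ≤ c.

b≥ : (D : ℕ) (Wmax : ℚ) (x c : ℕ) → Set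
b≥ zero Wmax x c = x ℕ.≤ c
b≥ (suc zero) Wmax x c =
  x ℕ.* ↧ₙ Wmax ℕ.≤ c ℕ.* (2 ℕ.* ℤ.∣ ↥ Wmax ∣ ℕ.+ ↧ₙ Wmax)
b≥ (suc (suc k)) Wmax x c =
  (c ℕ.+ x ℕ.* suc k) ℕ.^ ↧ₙ Wmax
    ℕ.≤ (c ℕ.^ ↧ₙ Wmax) ℕ.* (suc (suc k) ℕ.^ (2 ℕ.* ℤ.∣ ↥ Wmax ∣ ℕ.+ ↧ₙ Wmax))

-- x ≤ s = sqrt(b n)  (x ≥ 0, n ≥ 1)   ⇔   x² / n ≤ b
≤s : (n D : ℕ) (Wmax : ℚ) (x : ℕ) → Set
≤s n D Wmax x = b≥ D Wmax (x ℕ.* x) n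

-- d(x,y) < d(A,y) = min_{a ∈ A} d(a,y)   (min over ∅ is +∞)

Closer : ∀ {n} → (Fin n → Fin n → ℚ) → Subset n → Fin n → Fin n → Set
Closer d A x y = ∀ a → a ∈ A → d x y < d a y

closer? : ∀ {n} (d : Fin n → Fin n → ℚ) (A : Subset n) x y → Dec (Closer d A x y)
closer? d A x y = all? λ a → dec a
  where
    dec : ∀ a → Dec (a ∈ A → d x y < d a y)
    dec a with a ∈? A | d x y <? d a y
    ... | _     | yes lt = yes λ _ → lt
    ... | no a∉ | no _   = yes λ a∈ → Data.Empty.⊥-elim (a∉ a∈)
      where import Data.Empty
    ... | yes a∈ | no nlt = no λ f → nlt (f a∈)

hits : ∀ {n} (d : Fin n → Fin n → ℚ) (A : Subset n) (x : Fin n) → List (Fin n) → ℕ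
hits d A x X = length (filter (closer? d A x) X)

-- ESTIMATED-CENTERS(V, s), as the set of all possible executions.
-- EC A W A* : starting from the current A and W, the loop can terminate
-- with output A*.  T is the (positive) number of samples per vertex.

module Centers {n : ℕ} (d : Fin n → Fin n → ℚ) (D : ℕ) (Wmax : ℚ) (T : ℕ) where

  -- possible outcomes of SAMPLE(W, s)
  Sample : Subset n → Subset n → Set
  Sample W A' = (≤s n D Wmax ∣ W ∣ × A' ≡ W)
              ⊎ (¬ ≤s n D Wmax ∣ W ∣ × A' ⊆ W)

  -- C̃(x) = c·N/T ≥ 5N/s   ⇔   c > 0 and 25T²/(c² N) ≤ b   (N = n)
  Keep : ℕ → Set
  Keep c = (0 ℕ.< c) × b≥ D Wmax (25 ℕ.* T ℕ.* T) (c ℕ.* c ℕ.* n)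

  data EC : Subset n → Subset n → Subset n → Set where
    done : ∀ {A W} → Empty W → EC A W A
    step : ∀ {A W A' W' A*} →
           ¬ Empty W →
           Sample W A' →
           (X : Fin n → List (Fin n)) →
           (∀ x → length (X x) ≡ T) →
           (∀ x → (x ∈ W') ⇔ ((x ∈ W) × Keep (hits d (A ∪ A') x (X x)))) →
           EC (A ∪ A') W' A* →
           EC A W A*

N₂ : ∀ {n} → (Fin n → Fin n → ℚ) → ℚ → Fin n → Fin n → Set
N₂ d Wmax a v = d a v ≤ ((1ℚ + 1ℚ) * Wmax)

InD : ∀ {n} → (Fin n → Fin n → ℚ) → ℚ → Subset n → Fin n → Fin n → Set
InD d Wmax A a v = N₂ d Wmax a v ⊎ ∃ (λ b' → N₂ d Wmax a b' × Closer d A b' v)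

{-# OPTIONS --safe #-}
-- While A = ∅ every vertex is vacuously closer to each sample than A, so the
-- first round of ESTIMATED-CENTERS keeps all of V unless it samples all of V:
-- when n > s the graph cannot be a single edge, so D ≥ 2, b ≥ 1 + D + D² and
-- hence s ≥ 5, i.e. C̃(x) = N ≥ 5N/s.  So A ≠ ∅.  For an edge uv choose a ∈ A
-- minimising min(d(a,u), d(a,v)), attained say at u.  If d(a,u) ≤ Wmax then
-- u, v ∈ N₂(a).  Otherwise follow a shortest a–u path until its weight first
-- exceeds w(u,v); the vertex b reached has d(a,b) ≤ w(u,v) + Wmax ≤ 2 Wmax and
-- d(b,u) + w(u,v) < d(a,u) ≤ d(A,u), d(A,v), so u, v ∈ C(b) ⊆ D_a.
module Submission where

open import Defs
open import Data.Nat as ℕ using (ℕ)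
open import Data.Rational using (ℚ)
open import Data.Fin using (Fin)
open import Data.Fin.Subset using (Subset; ⊥; ⊤; _∈_)
open import Data.Bool using (true)
open import Data.Product using (∃; _×_)
open import Relation.Binary.PropositionalEquality using (_≡_; refl; sym; trans; cong; cong₂; subst; subst₂)

module WalkGeometry {n : ℕ} (G : WGraph n) where

  open import Data.Rational using (0ℚ; 1ℚ; _+_; _*_; _≤_; _<_; _⊓_)
  open import Data.Rational.Properties
  open import Data.Product using (Σ; _,_; proj₁; proj₂)
  open import Data.Sum using (inj₁; inj₂)
  open import Relation.Nullary using (yes; no; contradiction)

  [1+1]*q≡q+q : ∀ q → (1ℚ + 1ℚ) * q ≡ q + q
  [1+1]*q≡q+q q = trans (*-distribʳ-+ q 1ℚ 1ℚ) (cong₂ _+_ (*-identityˡ q) (*-identityˡ q))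

  infixr 5 _++ʷ_

  _++ʷ_ : ∀ {x y z} → Walk G x y → Walk G y z → Walk G x z
  []      ++ʷ q = q
  (e ∷ p) ++ʷ q = e ∷ (p ++ʷ q)

  weight-++ʷ : ∀ {x y z} (p : Walk G x y) (q : Walk G y z) →
               weight (p ++ʷ q) ≡ weight p + weight q
  weight-++ʷ []                q = sym (+-identityˡ (weight q))
  weight-++ʷ (_∷_ {x} {y} e p) q = trans (cong (w G x y +_) (weight-++ʷ p q))
                                         (sym (+-assoc (w G x y) (weight p) (weight q)))

  edge : ∀ {x y} → adj G x y ≡ true → Walk G x y
  edge e = e ∷ []

  weight-edge : ∀ {x y} (e : adj G x y ≡ true) → weight (edge e) ≡ w G x y
  weight-edge {x} {y} _ = +-identityʳ (w G x y)

  module _ {Wmax : ℚ} (weights : WeightsIn G Wmax) where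

    0≤w : ∀ {x y} → adj G x y ≡ true → 0ℚ ≤ w G x y
    0≤w {x} {y} e = ≤-trans (nonNegative⁻¹ 1ℚ) (proj₁ (weights x y e))

    w≤Wmax : ∀ {x y} → adj G x y ≡ true → w G x y ≤ Wmax
    w≤Wmax {x} {y} e = proj₂ (weights x y e)

    record Crossing {x u : Fin n} (p : Walk G x u) (c t : ℚ) : Set where
      field
        mid    : Fin n
        prefix : Walk G x mid
        suffix : Walk G mid u
        splits : weight prefix + weight suffix ≡ weight p
        beyond : t < c + weight prefix
        within : c + weight prefix ≤ t + Wmax

    -- c is the weight accumulated before p; it lets crossing recurse on the tail.
    -- Edges weigh at most Wmax, so the first prefix passing t overshoots it by ≤ Wmax.
    crossing : ∀ {x u} (p : Walk G x u) {c t : ℚ} →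
               c ≤ t → t < c + weight p → Crossing p c t
    crossing [] {c} c≤t t<c+0 =
      contradiction (<-≤-trans (subst (_ <_) (+-identityʳ c) t<c+0) c≤t) (<-irrefl refl)
    crossing (_∷_ {x} {y} e p) {c} {t} c≤t t<c+wp with t <? c + w G x y
    ... | yes t<c+w = record
      { mid    = y
      ; prefix = edge e
      ; suffix = p
      ; splits = cong (_+ weight p) (weight-edge e)
      ; beyond = subst (λ z → t < c + z) (sym (weight-edge e)) t<c+w
      ; within = subst (λ z → c + z ≤ t + Wmax) (sym (weight-edge e))
                       (+-mono-≤ c≤t (w≤Wmax e))
      }
    ... | no t≮c+w = record
      { mid    = mid
      ; prefix = e ∷ prefix
      ; suffix = suffix
      ; splits = trans (+-assoc (w G x y) (weight prefix) (weight suffix))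
                       (cong (w G x y +_) splits)
      ; beyond = subst (t <_) (+-assoc c (w G x y) (weight prefix)) beyond
      ; within = subst (_≤ t + Wmax) (+-assoc c (w G x y) (weight prefix)) within
      }
      where
        open Crossing (crossing p (≮⇒≥ t≮c+w)
                        (subst (t <_) (sym (+-assoc c (w G x y) (weight p))) t<c+wp))

    module _ {d : Fin n → Fin n → ℚ} (dist : IsDistance G d) where

      shortest : ∀ x y → Σ (Walk G x y) λ p → weight p ≡ d x y
      shortest x y = proj₁ (dist x y)

      d≤weight : ∀ {x y} (p : Walk G x y) → d x y ≤ weight p
      d≤weight {x} {y} = proj₂ (dist x y)

      d-edge : ∀ a {x y} → adj G x y ≡ true → d a y ≤ d a x + w G x y
      d-edge a {x} {y} e with shortest a x
      ... | p , weight-p = begin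
        d a y                      ≤⟨ d≤weight (p ++ʷ edge e) ⟩
        weight (p ++ʷ edge e)      ≡⟨ weight-++ʷ p (edge e) ⟩
        weight p + weight (edge e) ≡⟨ cong₂ _+_ weight-p (weight-edge e) ⟩
        d a x + w G x y            ∎
        where open ≤-Reasoning

      near-both : ∀ a {x y} → adj G x y ≡ true → d a x ≤ Wmax → N₂ d Wmax a x × N₂ d Wmax a y
      near-both a {x} {y} e near = ≤-trans near Wmax≤2Wmax , y-near
        where
          open ≤-Reasoning
          Wmax≤2Wmax : Wmax ≤ (1ℚ + 1ℚ) * Wmax
          Wmax≤2Wmax = begin
            Wmax             ≡⟨ sym (+-identityˡ Wmax) ⟩
            0ℚ + Wmax        ≤⟨ +-monoˡ-≤ Wmax (≤-trans (0≤w e) (w≤Wmax e)) ⟩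
            Wmax + Wmax      ≡⟨ sym ([1+1]*q≡q+q Wmax) ⟩
            (1ℚ + 1ℚ) * Wmax ∎
          y-near : N₂ d Wmax a y
          y-near = begin
            d a y            ≤⟨ d-edge a e ⟩
            d a x + w G x y  ≤⟨ +-mono-≤ near (w≤Wmax e) ⟩
            Wmax + Wmax      ≡⟨ sym ([1+1]*q≡q+q Wmax) ⟩
            (1ℚ + 1ℚ) * Wmax ∎

      -- The point where a shortest a–x walk first passes weight w(x,y).
      shortcut : ∀ a {x y} → adj G x y ≡ true → Wmax < d a x →
                 ∃ λ b → N₂ d Wmax a b × d b x + w G x y < d a x
      shortcut a {x} {y} e far = mid , mid-near , via-mid<d-a-x
        where
          open ≤-Reasoning
          p : Walk G a x
          p = proj₁ (shortest a x)
          weight-p : weight p ≡ d a x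
          weight-p = proj₂ (shortest a x)
          w<weight-p : w G x y < 0ℚ + weight p
          w<weight-p = begin-strict
            w G x y       ≤⟨ w≤Wmax e ⟩
            Wmax          <⟨ far ⟩
            d a x         ≡⟨ sym weight-p ⟩
            weight p      ≡⟨ sym (+-identityˡ (weight p)) ⟩
            0ℚ + weight p ∎
          open Crossing (crossing p (0≤w e) w<weight-p)
          mid-near : N₂ d Wmax a mid
          mid-near = begin
            d a mid            ≤⟨ d≤weight prefix ⟩
            weight prefix      ≡⟨ sym (+-identityˡ (weight prefix)) ⟩
            0ℚ + weight prefix ≤⟨ within ⟩
            w G x y + Wmax     ≤⟨ +-monoˡ-≤ Wmax (w≤Wmax e) ⟩
            Wmax + Wmax        ≡⟨ sym ([1+1]*q≡q+q Wmax) ⟩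
            (1ℚ + 1ℚ) * Wmax   ∎
          w<weight-prefix : w G x y < weight prefix
          w<weight-prefix = subst (w G x y <_) (+-identityˡ (weight prefix)) beyond
          via-mid<d-a-x : d mid x + w G x y < d a x
          via-mid<d-a-x = begin-strict
            d mid x + w G x y             ≤⟨ +-monoˡ-≤ (w G x y) (d≤weight suffix) ⟩
            weight suffix + w G x y       <⟨ +-monoʳ-< (weight suffix) w<weight-prefix ⟩
            weight suffix + weight prefix ≡⟨ +-comm (weight suffix) (weight prefix) ⟩
            weight prefix + weight suffix ≡⟨ splits ⟩
            weight p                      ≡⟨ weight-p ⟩
            d a x                         ∎

      covers : (A : Subset n) (a : Fin n) {x y : Fin n} → adj G x y ≡ true →
               (∀ c → c ∈ A → d a x ≤ d c x ⊓ d c y) →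
               InD d Wmax A a x × InD d Wmax A a y
      covers A a {x} {y} e a-nearest with d a x ≤? Wmax
      ... | yes near = let x-near , y-near = near-both a e near in inj₁ x-near , inj₁ y-near
      ... | no  far  with shortcut a e (≰⇒> far)
      ...   | b , b-near , via-b<d-a-x = inj₂ (b , b-near , closer-x) , inj₂ (b , b-near , closer-y)
        where
          open ≤-Reasoning
          closer-x : Closer d A b x
          closer-x c c∈A = begin-strict
            d b x             ≡⟨ sym (+-identityʳ (d b x)) ⟩
            d b x + 0ℚ        ≤⟨ +-monoʳ-≤ (d b x) (0≤w e) ⟩
            d b x + w G x y   <⟨ via-b<d-a-x ⟩
            d a x             ≤⟨ a-nearest c c∈A ⟩
            d c x ⊓ d c y     ≤⟨ p⊓q≤p (d c x) (d c y) ⟩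
            d c x             ∎
          closer-y : Closer d A b y
          closer-y c c∈A = begin-strict
            d b y             ≤⟨ d-edge b e ⟩
            d b x + w G x y   <⟨ via-b<d-a-x ⟩
            d a x             ≤⟨ a-nearest c c∈A ⟩
            d c x ⊓ d c y     ≤⟨ p⊓q≤q (d c x) (d c y) ⟩
            d c y             ∎

module ExpansionBound where

  open import Data.Nat
  open import Data.Nat.Properties
  open import Data.Nat.Tactic.RingSolver using (solve-∀)
  import Data.Integer as ℤ
  import Data.Integer.Properties as ℤ
  open import Data.Rational as ℚ using (1ℚ; ↥_; ↧_; ↧ₙ_)
  import Data.Rational.Properties as ℚ

  ^-distribʳ-* : ∀ m n o → (m * n) ^ o ≡ m ^ o * n ^ o
  ^-distribʳ-* m n zero    = refl
  ^-distribʳ-* m n (suc o) = begin-equality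
    m * n * (m * n) ^ o       ≡⟨ cong (m * n *_) (^-distribʳ-* m n o) ⟩
    m * n * (m ^ o * n ^ o)   ≡⟨ interchange m n (m ^ o) (n ^ o) ⟩
    m * m ^ o * (n * n ^ o)   ∎
    where
      open ≤-Reasoning
      interchange : ∀ a b c e → a * b * (c * e) ≡ a * c * (b * e)
      interchange = solve-∀

  -- With Wmax = p/q, the exponent 2 Wmax + 1 of b is (2p + q)/q ≥ 3.
  1≤Wmax⇒3↧≤2∣↥∣+↧ : ∀ {Wmax} → 1ℚ ℚ.≤ Wmax → 3 * ↧ₙ Wmax ≤ 2 * ℤ.∣ ↥ Wmax ∣ + ↧ₙ Wmax
  1≤Wmax⇒3↧≤2∣↥∣+↧ {Wmax} 1≤Wmax = begin
    3 * ↧ₙ Wmax               ≡⟨ +-comm (↧ₙ Wmax) (2 * ↧ₙ Wmax) ⟩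
    2 * ↧ₙ Wmax + ↧ₙ Wmax     ≤⟨ +-monoˡ-≤ (↧ₙ Wmax) (*-monoʳ-≤ 2 ↧≤↥) ⟩
    2 * ℤ.∣ ↥ Wmax ∣ + ↧ₙ Wmax ∎
    where
      open ≤-Reasoning
      +≤⇒≤∣∣ : ∀ {m i} → ℤ.+ m ℤ.≤ i → m ≤ ℤ.∣ i ∣
      +≤⇒≤∣∣ (ℤ.+≤+ m≤n) = m≤n
      ↧≤↥ : ↧ₙ Wmax ≤ ℤ.∣ ↥ Wmax ∣
      ↧≤↥ = +≤⇒≤∣∣ (subst₂ ℤ._≤_ (ℤ.*-identityˡ (↧ Wmax)) (ℤ.*-identityʳ (↥ Wmax))
                                 (ℚ.drop-*≤* 1≤Wmax))

  geometric-series : ∀ c k → c + c * (1 + (2 + k) + (2 + k) * (2 + k)) * (1 + k) ≡ c * (2 + k) ^ 3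
  geometric-series = unfolded
    where
      -- the ring solver needs the power written out
      unfolded : ∀ c k → c + c * (1 + (2 + k) + (2 + k) * (2 + k)) * (1 + k)
                         ≡ c * ((2 + k) * ((2 + k) * ((2 + k) * 1)))
      unfolded = solve-∀

  -- b = 1 + D + ⋯ + D^(2 Wmax) ≥ 1 + D + D² because 2 Wmax ≥ 2.
  b≥-≤1+D+D² : ∀ D {Wmax} x c → 1ℚ ℚ.≤ Wmax → x ≤ c * (1 + D + D * D) → b≥ D Wmax x c
  b≥-≤1+D+D² zero                x c _      x≤c = subst (x ≤_) (*-identityʳ c) x≤c
  b≥-≤1+D+D² (suc zero)    {Wmax} x c 1≤Wmax x≤3c = begin
    x * ↧ₙ Wmax                    ≤⟨ *-monoˡ-≤ (↧ₙ Wmax) x≤3c ⟩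
    c * 3 * ↧ₙ Wmax                ≡⟨ *-assoc c 3 (↧ₙ Wmax) ⟩
    c * (3 * ↧ₙ Wmax)              ≤⟨ *-monoʳ-≤ c (1≤Wmax⇒3↧≤2∣↥∣+↧ 1≤Wmax) ⟩
    c * (2 * ℤ.∣ ↥ Wmax ∣ + ↧ₙ Wmax) ∎
    where open ≤-Reasoning
  b≥-≤1+D+D² (suc (suc k)) {Wmax} x c 1≤Wmax x≤ = begin
    (c + x * suc k) ^ q     ≤⟨ ^-monoˡ-≤ q (+-monoʳ-≤ c (*-monoˡ-≤ (suc k) x≤)) ⟩
    (c + c * (1 + D + D * D) * suc k) ^ q ≡⟨ cong (_^ q) (geometric-series c k) ⟩
    (c * D ^ 3) ^ q         ≡⟨ ^-distribʳ-* c (D ^ 3) q ⟩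
    c ^ q * (D ^ 3) ^ q     ≡⟨ cong (c ^ q *_) (^-*-assoc D 3 q) ⟩
    c ^ q * D ^ (3 * q)     ≤⟨ *-monoʳ-≤ (c ^ q) (^-monoʳ-≤ D (1≤Wmax⇒3↧≤2∣↥∣+↧ 1≤Wmax)) ⟩
    c ^ q * D ^ (2 * ℤ.∣ ↥ Wmax ∣ + q) ∎
    where
      open ≤-Reasoning
      D = suc (suc k)
      q = ↧ₙ Wmax

module Degrees {n : ℕ} (G : WGraph n) where

  open import Data.Nat using (_≤_; _<_; z≤n; s≤s)
  open import Data.Nat.Properties using (≤-trans; <⇒≱)
  open import Data.Fin using (zero; suc; _≟_)
  open import Data.Fin.Properties using (injective⇒≤)
  open import Data.Fin.Subset using (∣_∣)
  open import Data.Fin.Subset.Properties using (x∈p⇒∣p-x∣<∣p∣; x∈p∧x∉q⇒x∈p─q; x≢y⇒x∉⁅y⁆)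
  open import Data.Vec.Properties using (lookup⇒[]=; lookup∘tabulate)
  open import Data.Product using (proj₁)
  open import Data.Sum using (_⊎_; inj₁; inj₂)
  open import Function using (_∘_)
  open import Relation.Nullary using (¬_; yes; no; contradiction)

  ∈-nbhd : ∀ {u x} → adj G u x ≡ true → x ∈ nbhd G u
  ∈-nbhd {u} {x} e = lookup⇒[]= x _ (trans (lookup∘tabulate (adj G u) x) e)

  x∈p⇒0<∣p∣ : ∀ {p : Subset n} {x} → x ∈ p → 0 < ∣ p ∣
  x∈p⇒0<∣p∣ x∈p = ≤-trans (s≤s z≤n) (x∈p⇒∣p-x∣<∣p∣ x∈p)

  0<deg : ∀ {u x} → adj G u x ≡ true → 0 < deg G u
  0<deg e = x∈p⇒0<∣p∣ (∈-nbhd e)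

  1<deg : ∀ {u x y} → adj G u x ≡ true → adj G u y ≡ true → ¬ y ≡ x → 1 < deg G u
  1<deg ux uy y≢x =
    ≤-trans (s≤s (x∈p⇒0<∣p∣ (x∈p∧x∉q⇒x∈p─q (∈-nbhd uy) (x≢y⇒x∉⁅y⁆ y≢x))))
            (x∈p⇒∣p-x∣<∣p∣ (∈-nbhd ux))

  module _ (undirected : IsUndirected G) (connected : Connected G)
           (deg≤1 : ∀ u → deg G u ≤ 1) {u v : Fin n} (uv : adj G u v ≡ true) where

    neighbour-unique : ∀ {x y z} → adj G x y ≡ true → adj G x z ≡ true → z ≡ y
    neighbour-unique {x} {y} {z} xy xz with z ≟ y
    ... | yes z≡y = z≡y
    ... | no  z≢y = contradiction (deg≤1 x) (<⇒≱ (1<deg xy xz z≢y))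

    walk-stays : ∀ {x y} → Walk G x y → x ≡ u ⊎ x ≡ v → y ≡ u ⊎ y ≡ v
    walk-stays []        x∈uv         = x∈uv
    walk-stays (xz ∷ p) (inj₁ refl) = walk-stays p (inj₂ (neighbour-unique uv xz))
    walk-stays (xz ∷ p) (inj₂ refl) =
      walk-stays p (inj₁ (neighbour-unique (trans (proj₁ undirected v u) uv) xz))

    n≤2 : n ≤ 2
    n≤2 = injective⇒≤ {f = side ∘ endpoint} (side-injective (endpoint _) (endpoint _))
      where
        endpoint : ∀ x → x ≡ u ⊎ x ≡ v
        endpoint x = walk-stays (connected u x) (inj₁ refl)
        side : ∀ {x} → x ≡ u ⊎ x ≡ v → Fin 2
        side (inj₁ _) = zero
        side (inj₂ _) = suc zero
        side-injective : ∀ {x y} (ex : x ≡ u ⊎ x ≡ v) (ey : y ≡ u ⊎ y ≡ v) → side ex ≡ side ey → x ≡ y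
        side-injective (inj₁ refl) (inj₁ refl) _ = refl
        side-injective (inj₂ refl) (inj₂ refl) _ = refl
        side-injective (inj₁ _)    (inj₂ _)    ()
        side-injective (inj₂ _)    (inj₁ _)    ()

module EstimatedCenters {n : ℕ} (d : Fin n → Fin n → ℚ) (D : ℕ) (Wmax : ℚ) (T : ℕ) where

  open Centers d D Wmax T
  open import Data.Fin.Subset using (Nonempty; Empty; _∪_)
  open import Data.Fin.Subset.Properties using (nonempty?; x∈p∪q⁺; ⊆-antisym; ⊆⊤; ∈⊤; ∣⊤∣≡n)
  open import Data.List using (length; filter)
  open import Data.List.Properties using (filter-all)
  open import Data.List.Relation.Unary.All using (universal)
  open import Data.Product using (_,_)
  open import Data.Sum using (_⊎_; inj₁; inj₂)
  open import Function.Bundles using (Equivalence)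
  open import Relation.Nullary using (yes; no; contradiction)

  hits-Empty : ∀ {A} → Empty A → ∀ x X → hits d A x X ≡ length X
  hits-Empty {A} A-empty x X =
    cong length (filter-all (closer? d A x)
                            (universal (λ _ a a∈A → contradiction (a , a∈A) A-empty) X))

  EC-nonempty : Fin n → ≤s n D Wmax n ⊎ Keep T →
                ∀ {A W A*} → EC A W A* → Nonempty A ⊎ W ≡ ⊤ → Nonempty A*
  EC-nonempty x _ (done _)             (inj₁ A-nonempty) = A-nonempty
  EC-nonempty x _ (done W-empty)       (inj₂ refl)       = contradiction (x , ∈⊤) W-empty
  EC-nonempty x small-or-keep (step _ _ _ _ _ rest) (inj₁ (a , a∈A)) =
    EC-nonempty x small-or-keep rest (inj₁ (a , x∈p∪q⁺ (inj₁ a∈A)))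
  EC-nonempty x small-or-keep (step {A} {A' = A'} {W'} _ sample X length-X kept rest) (inj₂ refl)
    with nonempty? (A ∪ A')
  ... | yes AA'-nonempty = EC-nonempty x small-or-keep rest (inj₁ AA'-nonempty)
  ... | no  AA'-empty    = EC-nonempty x small-or-keep rest (inj₂ W'≡⊤)
    where
      keep : Sample ⊤ A' → ≤s n D Wmax n ⊎ Keep T → Keep T
      keep (inj₁ (_ , A'≡⊤))  _             =
        contradiction (x , x∈p∪q⁺ (inj₂ (subst (x ∈_) (sym A'≡⊤) ∈⊤))) AA'-empty
      keep (inj₂ (large , _)) (inj₁ small)  =
        contradiction (subst (≤s n D Wmax) (sym (∣⊤∣≡n n)) small) large
      keep (inj₂ _)           (inj₂ keep-T) = keep-T
      all-hit : ∀ y → hits d (A ∪ A') y (X y) ≡ T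
      all-hit y = trans (hits-Empty AA'-empty y (X y)) (length-X y)
      W'≡⊤ : W' ≡ ⊤
      W'≡⊤ = ⊆-antisym ⊆⊤ λ {y} _ →
        Equivalence.from (kept y) (∈⊤ , subst Keep (sym (all-hit y)) (keep sample small-or-keep))

module SampleSize {n : ℕ} (G : WGraph n) {D : ℕ} {Wmax : ℚ} (undirected : IsUndirected G)
                  (connected : Connected G) (max-degree : IsMaxDegree G D)
                  (weights : WeightsIn G Wmax) {u v : Fin n} (uv : adj G u v ≡ true) where

  open import Data.Nat
  open import Data.Nat.Properties
  open import Data.Nat.Tactic.RingSolver using (solve-∀)
  open import Data.Rational as ℚ using (1ℚ)
  import Data.Rational.Properties as ℚ
  open import Data.Product using (_,_; proj₁; proj₂)
  open import Data.Sum using (_⊎_; inj₁; inj₂)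
  open import Relation.Nullary using (yes; no; contradiction)
  open Degrees G using (0<deg; n≤2)
  open ExpansionBound using (b≥-≤1+D+D²)

  rearrange : ∀ t a b → a * b * t * t ≡ t * t * a * b
  rearrange = solve-∀

  1≤Wmax : 1ℚ ℚ.≤ Wmax
  1≤Wmax = ℚ.≤-trans (proj₁ (weights u v uv)) (proj₂ (weights u v uv))

  n≤1+D+D²⇒n≤s : ∀ D → n ≤ 1 + D + D * D → ≤s n D Wmax n
  n≤1+D+D²⇒n≤s D n≤ = b≥-≤1+D+D² D (n * n) n 1≤Wmax (*-monoʳ-≤ n n≤)

  n≤s⊎Keep : (d : Fin n → Fin n → ℚ) {T : ℕ} → 0 < T →
             ≤s n D Wmax n ⊎ Centers.Keep d D Wmax T T
  n≤s⊎Keep d {T} 0<T = by-degree D max-degree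
    where
      by-degree : ∀ D → IsMaxDegree G D → ≤s n D Wmax n ⊎ Centers.Keep d D Wmax T T
      by-degree zero          (deg≤0 , _) = contradiction (deg≤0 u) (<⇒≱ (0<deg uv))
      by-degree (suc zero)    (deg≤1 , _) =
        inj₁ (n≤1+D+D²⇒n≤s 1 (≤-trans (n≤2 undirected connected deg≤1 uv) (n≤1+n 2)))
      by-degree (suc (suc k)) _ with n ≤? 1 + (2 + k) + (2 + k) * (2 + k)
      ... | yes n≤ = inj₁ (n≤1+D+D²⇒n≤s (2 + k) n≤)
      ... | no  n≰ = inj₂ (0<T , b≥-≤1+D+D² (2 + k) (25 * T * T) (T * T * n) 1≤Wmax (begin
            25 * T * T       ≤⟨ *-monoˡ-≤ T (*-monoˡ-≤ T (*-mono-≤ 5≤n 5≤1+D+D²)) ⟩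
            n * m * T * T    ≡⟨ rearrange T n m ⟩
            T * T * n * m    ∎))
        where
          open ≤-Reasoning
          m : ℕ
          m = 1 + (2 + k) + (2 + k) * (2 + k)
          5≤1+D+D² : 5 ≤ m
          5≤1+D+D² = ≤-trans (m≤m+n 5 2) (+-mono-≤ (+-monoʳ-≤ 1 2≤2+k) (*-mono-≤ 2≤2+k 2≤2+k))
            where 2≤2+k = m≤m+n 2 k
          5≤n : 5 ≤ n
          5≤n = ≤-trans 5≤1+D+D² (<⇒≤ (≰⇒> n≰))

module Minimiser {n : ℕ} where

  open import Data.Rational using (_≤_)
  open import Data.Rational.Properties using (≤-decTotalOrder)
  open import Relation.Binary.Bundles using (DecTotalOrder)
  open import Data.Fin.Subset using (Nonempty)
  open import Data.Fin.Subset.Properties using (_∈?_)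
  open import Data.List using (List; filter; allFin)
  open import Data.List.Extrema (DecTotalOrder.totalOrder ≤-decTotalOrder) using (argmin; argmin-all; f[argmin]≤f[xs])
  open import Data.List.Membership.Propositional.Properties using (∈-allFin; ∈-filter⁺)
  open import Data.List.Relation.Unary.All using (lookup)
  open import Data.List.Relation.Unary.All.Properties using (all-filter)
  open import Data.Product using (_,_)

  minimiser : (f : Fin n → ℚ) {A : Subset n} → Nonempty A →
              ∃ λ a → a ∈ A × (∀ c → c ∈ A → f a ≤ f c)
  minimiser f {A} (a₀ , a₀∈A) =
      argmin f a₀ members
    , argmin-all f a₀∈A (all-filter (_∈? A) (allFin n))
    , λ c c∈A → lookup (f[argmin]≤f[xs] a₀ members) (∈-filter⁺ (_∈? A) (∈-allFin c) c∈A)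
    where
      members : List (Fin n)
      members = filter (_∈? A) (allFin n)

lemma8 : (n : ℕ) (G : WGraph n) (D : ℕ) (Wmax : ℚ) (d : Fin n → Fin n → ℚ) (T : ℕ)
    → IsUndirected G → Connected G → IsMaxDegree G D → WeightsIn G Wmax
    → IsDistance G d → 0 ℕ.< T
    → (A : Subset n) → Centers.EC d D Wmax T ⊥ ⊤ A
    → ∀ u v → adj G u v ≡ true
    → ∃ λ a → a ∈ A × InD d Wmax A a u × InD d Wmax A a v
lemma8 n G D Wmax d T undirected connected max-degree weights dist 0<T A ec u v uv =
  covering-centre (minimiser (λ c → d c u ⊓ d c v) A-nonempty)
  where
    open import Data.Rational using (_≤_; _⊓_)
    open import Data.Rational.Properties using (⊓-sel; ⊓-comm)
    open import Data.Fin.Subset using (Nonempty)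
    open import Data.Product using (_,_; proj₁; swap)
    open import Data.Sum using (inj₁; inj₂)
    open WalkGeometry G using (covers)
    open EstimatedCenters d D Wmax T using (EC-nonempty)
    open SampleSize G undirected connected max-degree weights uv using (n≤s⊎Keep)
    open Minimiser using (minimiser)

    A-nonempty : Nonempty A
    A-nonempty = EC-nonempty u (n≤s⊎Keep d 0<T) ec (inj₂ refl)

    covering-centre : (∃ λ a → a ∈ A × (∀ c → c ∈ A → d a u ⊓ d a v ≤ d c u ⊓ d c v)) →
                      ∃ λ a → a ∈ A × InD d Wmax A a u × InD d Wmax A a v
    covering-centre (a , a∈A , a-min) with ⊓-sel (d a u) (d a v)
    ... | inj₁ ⊓≡u = a , a∈A , covers weights dist A a uv
                       (λ c c∈A → subst (_≤ _) ⊓≡u (a-min c c∈A))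
    ... | inj₂ ⊓≡v = a , a∈A , swap (covers weights dist A a (trans (proj₁ undirected v u) uv)
                       (λ c c∈A → subst₂ _≤_ ⊓≡v (⊓-comm (d c u) (d c v)) (a-min c c∈A)))
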